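{- For all $n\ge 1$, $d(n)\ge 2^{n-1}$.
   Context: For a finite set $A$ of positive integers, write $\sum A$ for the sum of its elements (with $\sum\emptyset=0$). A subset $B\subseteq A$ is a divisor of $A$ if $\sum B$ divides $\sum A$ (the empty set divides no nonempty set). $d(A)$ is the number of divisors of $A$, and $d(n)$ is the maximum of $d(A)$ over all sets $A$ of $n$ positive integers. -}

module Defs where

open import Data.Nat using (ℕ; zero; suc; _+_; _≤_; _^_; _∸_)
open import Data.Nat.Divisibility using (_∣_; _∣?_)
open import Data.Bool using (Bool; true; false)
open import Data.Fin using (Fin; zero; suc)
open import Data.Vec using (Vec; []; _∷_; lookup; tabulate)
open import Data.List as List using (List; length; filter)
open import Data.Fin.Subset using (Subset; inside; outside)
open import Data.Product using (_×_)
open import Relation.Nullary using (¬_)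
open import Relation.Nullary.Decidable using (_×-dec_; ¬?)
open import Relation.Binary.PropositionalEquality using (_≡_)
open import Data.Nat using (_≟_)

-- A finite set of n positive integers, represented by an injective
-- enumeration Fin n → ℕ with all values positive.
IsSetOfPositives : (n : ℕ) → (Fin n → ℕ) → Set
IsSetOfPositives n a =
  (∀ i → 1 ≤ a i) × (∀ i j → a i ≡ a j → i ≡ j)

sumAll : (n : ℕ) → (Fin n → ℕ) → ℕ
sumAll zero    a = 0
sumAll (suc n) a = a zero + sumAll n (λ i → a (suc i))

sumSub : (n : ℕ) → (Fin n → ℕ) → Subset n → ℕ
sumSub zero    a []             = 0
sumSub (suc n) a (true  ∷ b)    = a zero + sumSub n (λ i → a (suc i)) b
sumSub (suc n) a (false ∷ b)    = sumSub n (λ i → a (suc i)) b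

allSubsets : (n : ℕ) → List (Subset n)
allSubsets zero    = [] List.∷ List.[]
allSubsets (suc n) =
  List.map (outside ∷_) (allSubsets n) List.++ List.map (inside ∷_) (allSubsets n)

-- B is a divisor of A: ∑ B divides ∑ A, and B is not empty-sum
-- (the empty set divides no nonempty set; since elements are positive,
-- ∑ B = 0 iff B = ∅).
IsDivisor : (n : ℕ) → (Fin n → ℕ) → Subset n → Set
IsDivisor n a b = (¬ sumSub n a b ≡ 0) × (sumSub n a b ∣ sumAll n a)

dSet : (n : ℕ) → (Fin n → ℕ) → ℕ
dSet n a = length (filter (λ b → ¬? (sumSub n a b ≟ 0) ×-dec (sumSub n a b ∣? sumAll n a))
                          (allSubsets n))

-- Adjoin to {1, …, m} one large element x such that the total is a factorial K!
-- with K at least 1 + ⋯ + m.  Every nonempty subset of {1, …, m} then has sum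
-- at most K, hence divides K!; together with A itself this gives
-- (2^m − 1) + 1 = 2^(n−1) divisors of the n = m + 1 element set A.
module Submission where

open import Defs
open import Data.Nat using (ℕ; _≤_; _^_; _∸_)
open import Data.Fin using (Fin)
open import Data.Product using (Σ; _×_)

open import Data.Nat using (zero; suc; _+_; _<_; _!; s≤s; z≤n; _≟_)
open import Data.Nat.Properties
open import Data.Nat.Divisibility using (_∣_; _∣?_; ∣-refl; ∣-trans; m∣m*n; m≤n⇒m!∣n!)
open import Data.Fin using (zero; suc; toℕ)
open import Data.Fin.Properties using (toℕ<n; toℕ-injective)
open import Data.Fin.Subset using (Subset; inside; outside; ⊤)
open import Data.Bool using (true; false)
open import Data.Vec using ([]; _∷_)
import Data.Vec.Functional as Vector
open import Data.List as List using (List; length; filter; _++_)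
open import Data.List.Properties using (length-++; length-map; filter-++; filter-all; filter-some)
open import Data.List.Membership.Propositional using (_∈_; lose)
open import Data.List.Membership.Propositional.Properties using (∈-map⁺; ∈-++⁺ʳ)
open import Data.List.Relation.Unary.All as All using ()
open import Data.List.Relation.Unary.Any using (here)
open import Data.List.Relation.Binary.Sublist.Propositional using (⊆-refl)
open import Data.List.Relation.Binary.Sublist.Propositional.Properties using (filter⁺; length-mono-≤)
open import Data.Product using (_,_; proj₁)
open import Function using (_∘_)
open import Level using (Level)
open import Relation.Nullary using (¬_; does; contradiction)
open import Relation.Nullary.Decidable using (¬?; _×-dec_)
open import Relation.Unary using (Pred; Decidable)
open import Relation.Binary.PropositionalEquality

private variable
  ℓ ℓ′ : Level
  A B : Set

length-filter-map : {P : Pred B ℓ} (P? : Decidable P) (f : A → B) (xs : List A) →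
  length (filter P? (List.map f xs)) ≡ length (filter (P? ∘ f) xs)
length-filter-map P? f List.[] = refl
length-filter-map P? f (x List.∷ xs) with does (P? (f x))
... | true  = cong suc (length-filter-map P? f xs)
... | false = length-filter-map P? f xs

length-filter-mono : {P : Pred A ℓ} {Q : Pred A ℓ′} (P? : Decidable P) (Q? : Decidable Q) →
  (∀ {x} → P x → Q x) → (xs : List A) → length (filter P? xs) ≤ length (filter Q? xs)
length-filter-mono P? Q? P⇒Q xs = length-mono-≤ (filter⁺ P? Q? (λ { refl → P⇒Q }) (⊆-refl {x = xs}))

count-allSubsets-suc : ∀ n {P : Pred (Subset (suc n)) ℓ} (P? : Decidable P) →
  length (filter P? (allSubsets (suc n)))
    ≡ length (filter (P? ∘ (outside ∷_)) (allSubsets n)) + length (filter (P? ∘ (inside ∷_)) (allSubsets n))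
count-allSubsets-suc n P? = begin
  length (filter P? (outs ++ ins))                       ≡⟨ cong length (filter-++ P? outs ins) ⟩
  length (filter P? outs ++ filter P? ins)               ≡⟨ length-++ (filter P? outs) ⟩
  length (filter P? outs) + length (filter P? ins)       ≡⟨ cong₂ _+_ (length-filter-map P? (outside ∷_) (allSubsets n))
                                                                      (length-filter-map P? (inside ∷_) (allSubsets n)) ⟩
  length (filter (P? ∘ (outside ∷_)) (allSubsets n)) + length (filter (P? ∘ (inside ∷_)) (allSubsets n)) ∎
  where
  open ≡-Reasoning
  outs = List.map (outside ∷_) (allSubsets n)
  ins  = List.map (inside ∷_) (allSubsets n)

length-allSubsets : ∀ n → length (allSubsets n) ≡ 2 ^ n
length-allSubsets zero    = refl
length-allSubsets (suc n) = begin
  length (outs ++ ins)         ≡⟨ length-++ outs ⟩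
  length outs + length ins     ≡⟨ cong₂ _+_ (length-map (outside ∷_) (allSubsets n)) (length-map (inside ∷_) (allSubsets n)) ⟩
  length (allSubsets n) + length (allSubsets n) ≡⟨ cong (λ k → k + k) (length-allSubsets n) ⟩
  2 ^ n + 2 ^ n                ≡⟨ cong (2 ^ n +_) (+-identityʳ (2 ^ n)) ⟨
  2 ^ n + (2 ^ n + 0)          ∎
  where
  open ≡-Reasoning
  outs = List.map (outside ∷_) (allSubsets n)
  ins  = List.map (inside ∷_) (allSubsets n)

⊤∈allSubsets : ∀ n → ⊤ ∈ allSubsets n
⊤∈allSubsets zero    = here refl
⊤∈allSubsets (suc n) = ∈-++⁺ʳ (List.map (outside ∷_) (allSubsets n)) (∈-map⁺ (inside ∷_) (⊤∈allSubsets n))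

sumSub-⊤ : ∀ n (a : Fin n → ℕ) → sumSub n a ⊤ ≡ sumAll n a
sumSub-⊤ zero    a = refl
sumSub-⊤ (suc n) a = cong (a zero +_) (sumSub-⊤ n (a ∘ suc))

sumSub≤sumAll : ∀ n (a : Fin n → ℕ) b → sumSub n a b ≤ sumAll n a
sumSub≤sumAll zero    a []          = z≤n
sumSub≤sumAll (suc n) a (true ∷ b)  = +-monoʳ-≤ (a zero) (sumSub≤sumAll n (a ∘ suc) b)
sumSub≤sumAll (suc n) a (false ∷ b) = m≤n⇒m≤o+n (a zero) (sumSub≤sumAll n (a ∘ suc) b)

-- Only the empty subset has sum 0, so exactly one subset is missing.
suc-count-nonzeroSums : ∀ n (a : Fin n → ℕ) → (∀ i → 1 ≤ a i) →
  suc (length (filter (λ b → ¬? (sumSub n a b ≟ 0)) (allSubsets n))) ≡ 2 ^ n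
suc-count-nonzeroSums zero    a pos = refl
suc-count-nonzeroSums (suc n) a pos = begin
  suc (length (filter nonzero? (allSubsets (suc n))))
    ≡⟨ cong suc (count-allSubsets-suc n nonzero?) ⟩
  suc (length (filter (nonzero? ∘ (outside ∷_)) (allSubsets n)) + length (filter (nonzero? ∘ (inside ∷_)) (allSubsets n)))
    ≡⟨ cong₂ _+_ (suc-count-nonzeroSums n (a ∘ suc) (pos ∘ suc))
                 (cong length (filter-all (nonzero? ∘ (inside ∷_)) (All.universal inside-nonzero (allSubsets n)))) ⟩
  2 ^ n + length (allSubsets n)
    ≡⟨ cong (2 ^ n +_) (trans (length-allSubsets n) (sym (+-identityʳ (2 ^ n)))) ⟩
  2 ^ n + (2 ^ n + 0) ∎
  where
  open ≡-Reasoning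
  nonzero? = λ (b : Subset (suc n)) → ¬? (sumSub (suc n) a b ≟ 0)
  inside-nonzero : ∀ b → ¬ sumSub (suc n) a (inside ∷ b) ≡ 0
  inside-nonzero b = n>0⇒n≢0 (≤-trans (pos zero) (m≤m+n (a zero) _))

⊤-isDivisor : ∀ n (a : Fin n → ℕ) → ¬ sumAll n a ≡ 0 → IsDivisor n a ⊤
⊤-isDivisor n a nonzero rewrite sumSub-⊤ n a = nonzero , ∣-refl

-- The divisors counted are the nonempty subsets of C, and A = {x} ∪ C itself.
2^m≤dSet-∷ : ∀ m x (c : Fin m → ℕ) → 1 ≤ x → (∀ i → 1 ≤ c i) →
  (∀ b → ¬ sumSub m c b ≡ 0 → sumSub m c b ∣ x + sumAll m c) →
  2 ^ m ≤ dSet (suc m) (x Vector.∷ c)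
2^m≤dSet-∷ m x c 1≤x pos divides = begin
  2 ^ m                                          ≡⟨ suc-count-nonzeroSums m c pos ⟨
  suc (length (filter nonzero? (allSubsets m)))  ≡⟨ +-comm 1 _ ⟩
  length (filter nonzero? (allSubsets m)) + 1
    ≤⟨ +-mono-≤ (length-filter-mono nonzero? (isDivisor? ∘ (outside ∷_)) (λ {b} → outside-isDivisor b) (allSubsets m))
                (filter-some (isDivisor? ∘ (inside ∷_)) (lose (⊤∈allSubsets m) full-isDivisor)) ⟩
  length (filter (isDivisor? ∘ (outside ∷_)) (allSubsets m)) + length (filter (isDivisor? ∘ (inside ∷_)) (allSubsets m))
                                                 ≡⟨ count-allSubsets-suc m isDivisor? ⟨
  dSet (suc m) a                                 ∎
  where
  open ≤-Reasoning
  a = x Vector.∷ c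
  nonzero? = λ (b : Subset m) → ¬? (sumSub m c b ≟ 0)
  isDivisor? : Decidable (IsDivisor (suc m) a)
  isDivisor? b = ¬? (sumSub (suc m) a b ≟ 0) ×-dec (sumSub (suc m) a b ∣? sumAll (suc m) a)
  outside-isDivisor : ∀ b → ¬ sumSub m c b ≡ 0 → IsDivisor (suc m) a (outside ∷ b)
  outside-isDivisor b nonzero = nonzero , divides b nonzero
  full-isDivisor : IsDivisor (suc m) a ⊤
  full-isDivisor = ⊤-isDivisor (suc m) a (n>0⇒n≢0 (≤-trans 1≤x (m≤m+n x _)))

∣-! : ∀ {s n} → 1 ≤ s → s ≤ n → s ∣ n !
∣-! {suc s} _ s≤n = ∣-trans (m∣m*n (s !)) (m≤n⇒m!∣n! s≤n)

n≤n! : ∀ n → n ≤ n !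
n≤n! zero    = z≤n
n≤n! (suc n) = m≤m*n (suc n) (n !) {{n !≢0}}

staircase : ∀ m → Fin m → ℕ
staircase m = suc ∘ toℕ

staircase-isSetOfPositives : ∀ m → IsSetOfPositives m (staircase m)
staircase-isSetOfPositives m = (λ _ → s≤s z≤n) , (λ i j eq → toℕ-injective (suc-injective eq))

∷-isSetOfPositives : ∀ {m x} {c : Fin m → ℕ} → 1 ≤ x → (∀ i → c i < x) →
  IsSetOfPositives m c → IsSetOfPositives (suc m) (x Vector.∷ c)
∷-isSetOfPositives {x = x} {c} 1≤x c<x (pos , inj) = positive , injective
  where
  positive : ∀ i → 1 ≤ (x Vector.∷ c) i
  positive zero    = 1≤x
  positive (suc i) = pos i
  injective : ∀ i j → (x Vector.∷ c) i ≡ (x Vector.∷ c) j → i ≡ j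
  injective zero    zero    _  = refl
  injective zero    (suc j) eq = contradiction (sym eq) (<⇒≢ (c<x j))
  injective (suc i) zero    eq = contradiction eq (<⇒≢ (c<x i))
  injective (suc i) (suc j) eq = cong suc (inj i j eq)

mainTheorem4 : (n : ℕ) → 1 ≤ n →
    Σ (Fin n → ℕ) (λ a → IsSetOfPositives n a × (2 ^ (n ∸ 1) ≤ dSet n a))
mainTheorem4 (suc m) _ =
  x Vector.∷ c ,
  ∷-isSetOfPositives 1≤x (λ i → ≤-<-trans (toℕ<n i) m<x) (staircase-isSetOfPositives m) ,
  2^m≤dSet-∷ m x c 1≤x (proj₁ (staircase-isSetOfPositives m)) divides
  where
  c = staircase m
  N = sumAll m c
  K = N + suc m
  x = K ! ∸ N
  x+N≡K! : x + N ≡ K !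
  x+N≡K! = m∸n+n≡m (≤-trans (m≤m+n N (suc m)) (n≤n! K))
  m<x : m < x
  m<x = subst (_≤ x) (m+n∸m≡n N (suc m)) (∸-monoˡ-≤ N (n≤n! K))
  1≤x : 1 ≤ x
  1≤x = ≤-trans (s≤s z≤n) m<x
  divides : ∀ b → ¬ sumSub m c b ≡ 0 → sumSub m c b ∣ x + N
  divides b nonzero = subst (sumSub m c b ∣_) (sym x+N≡K!)
    (∣-! (n≢0⇒n>0 nonzero) (≤-trans (sumSub≤sumAll m c b) (m≤m+n N (suc m))))
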